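{- Let $T$ be an acyclic bipartite tournament. Then, for any subset $M\subseteq V(T)$, the canonical sequence of $T$ is a refinement of the $M$-sequence of $T$.
   Context: A bipartite tournament is a directed graph whose vertex set is partitioned into two sets $A,B$ such that every pair $a\in A$, $b\in B$ is joined by exactly one arc and there are no arcs inside $A$ or inside $B$. $N^+(v)$, $N^-(v)$ denote out- and in-neighbourhoods. For an acyclic bipartite tournament $D$, its canonical sequence $(V_1,V_2,\dots)$ is defined by: $V_i$ is the set of vertices with no incoming arcs in $D-\bigcup_{j<i}V_j$. $T$ is $M$-consistent if $T[M\cup\{v\}]$ is acyclic for every $v\in V(T)$ (an acyclic $T$ is $M$-consistent for every $M$). Two vertices $u,v$ are $M$-equivalent if $N^+(u)\cap M=N^+(v)\cap M$ and $N^-(u)\cap M=N^-(v)\cap M$. With $(Z_1,\dots,Z_l)$ the canonical sequence of $T[M]$: $v$ is $(M,Z_i)$-equivalent if $v$ is $M$-equivalent to some vertex of $Z_i$; $v$ is $(M,Z_i)$-conflicting if $N^+(v)\cap Z_i\neq\emptyset$, $N^-(v)\cap Z_i\neq\emptyset$, $N^+(v)\cap Z_j=\emptyset$ for all $j<i$ and $N^-(v)\cap Z_j=\emptyset$ for all $j>i$; $v$ is $M$-universal if it is not $(M,Z_i)$-equivalent for any $i$, $T[M\cup\{v\}]$ is acyclic, and some topological sort of $T[M\cup\{v\}]$ has $v$ first ($M^-$-universal) or last ($M^+$-universal). The $M$-sequence of an $M$-consistent $T$ is the sequence $(X_1,Y_1,\dots,X_l,Y_l)$ where $X_i$ is the set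 of all $(M,Z_i)$-equivalent vertices, $Y_i$ is the set of all $(M,Z_i)$-conflicting vertices, and additionally $Y_1$ contains every $M^-$-universal vertex and $Y_l$ every $M^+$-universal vertex. A partition $(V_1,V_2,\dots)$ of a set $U$ is a refinement of a partition $(W_1,W_2,\dots)$ of $U$ if for all $i,j$ either $V_i\subseteq W_j$ or $V_i\cap W_j=\emptyset$ (here the $M$-sequence is regarded as a partition of $V(T)$ into its nonempty parts). -}

module Defs where

open import Data.Nat using (ℕ; zero; suc; _<_)
open import Data.Bool using (Bool; T)
open import Data.Fin using (Fin)
import Data.Fin as F
open import Data.Fin.Subset using (Subset; _∈_)
open import Data.List using (List; _∷_; []; _++_; [_]; length; lookup)
open import Data.List.Relation.Unary.Unique.Propositional using (Unique)
import Data.List.Membership.Propositional as LM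
open import Data.Product using (Σ; ∃; _×_; _,_)
open import Data.Sum using (_⊎_)
open import Data.Empty using (⊥)
open import Data.Unit using (⊤)
open import Relation.Nullary using (¬_)
open import Relation.Binary.PropositionalEquality using (_≡_; _≢_)
open import Relation.Binary.Construct.Closure.Transitive using (TransClosure)
open import Function.Bundles using (_⇔_)

VSet : ℕ → Set₁
VSet n = Fin n → Set

-- A bipartite tournament on vertex set Fin n, with bipartition (A,B)
-- given by side (A = side false, B = side true); arc u v means u → v.
record BipTournament (n : ℕ) : Set where
  field
    side : Fin n → Bool
    arc  : Fin n → Fin n → Bool
  Arc : Fin n → Fin n → Set
  Arc u v = T (arc u v)
  field
    noArcInside : ∀ u v → side u ≡ side v → ¬ Arc u v
    exactlyOne  : ∀ u v → side u ≢ side v →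
                  (Arc u v × ¬ Arc v u) ⊎ (Arc v u × ¬ Arc u v)

open BipTournament public

module _ {n : ℕ} (D : BipTournament n) where

  ArcIn : VSet n → Fin n → Fin n → Set
  ArcIn S u v = S u × S v × Arc D u v

  AcyclicOn : VSet n → Set
  AcyclicOn S = ¬ (∃ λ v → TransClosure (ArcIn S) v v)

  Acyclic : Set
  Acyclic = AcyclicOn (λ _ → ⊤)

  -- Canonical sequence of D[S], 0-indexed: CanonIn S i is V_{i+1};
  -- RemovedIn S i is the union of V_1,...,V_i.
  mutual
    RemovedIn : VSet n → ℕ → VSet n
    RemovedIn S zero    v = ⊥
    RemovedIn S (suc i) v = RemovedIn S i v ⊎ CanonIn S i v

    CanonIn : VSet n → ℕ → VSet n
    CanonIn S i v = S v × ¬ RemovedIn S i v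
                    × (∀ u → S u → ¬ RemovedIn S i u → ¬ Arc D u v)

  Canon : ℕ → VSet n
  Canon = CanonIn (λ _ → ⊤)

  TopSort : VSet n → List (Fin n) → Set
  TopSort S xs = Unique xs × (∀ u → (u LM.∈ xs) ⇔ S u)
                 × (∀ i j → Arc D (lookup xs i) (lookup xs j) → i F.< j)

  module _ (M : Subset n) where

    InM : VSet n
    InM u = u ∈ M

    InMv : Fin n → VSet n
    InMv v u = u ∈ M ⊎ u ≡ v

    -- canonical sequence (Z_1, Z_2, ...) of D[M], 0-indexed
    Z : ℕ → VSet n
    Z = CanonIn InM

    IsSeqLength : ℕ → Set
    IsSeqLength l = (∀ i → i < l → ∃ λ z → Z i z) × (∀ z → ¬ Z l z)

    MConsistent : Set
    MConsistent = ∀ v → AcyclicOn (InMv v)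

    MEquivalent : Fin n → Fin n → Set
    MEquivalent u v =
      (∀ w → w ∈ M → Arc D u w ⇔ Arc D v w) ×
      (∀ w → w ∈ M → Arc D w u ⇔ Arc D w v)

    ZEquivalent : ℕ → Fin n → Set
    ZEquivalent i v = ∃ λ z → Z i z × MEquivalent v z

    ZConflicting : ℕ → Fin n → Set
    ZConflicting i v =
      (∃ λ z → Z i z × Arc D v z) ×
      (∃ λ z → Z i z × Arc D z v) ×
      (∀ j → j < i → ∀ z → Z j z → ¬ Arc D v z) ×
      (∀ j → i < j → ∀ z → Z j z → ¬ Arc D z v)

    UniversalBase : Fin n → Set
    UniversalBase v = (∀ i → ¬ ZEquivalent i v) × AcyclicOn (InMv v)

    MinusUniversal : Fin n → Set
    MinusUniversal v = UniversalBase v × (∃ λ ys → TopSort (InMv v) (v ∷ ys))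

    PlusUniversal : Fin n → Set
    PlusUniversal v = UniversalBase v × (∃ λ ys → TopSort (InMv v) (ys ++ [ v ]))

    -- M-sequence (X_1,Y_1,...,X_l,Y_l), 0-indexed: X i = X_{i+1}, Y l i = Y_{i+1}
    X : ℕ → VSet n
    X = ZEquivalent

    Y : ℕ → ℕ → VSet n
    Y l i v = ZConflicting i v
              ⊎ (i ≡ zero × MinusUniversal v)
              ⊎ (suc i ≡ l × PlusUniversal v)

SubsetOrDisjoint : ∀ {n} → VSet n → VSet n → Set
SubsetOrDisjoint V W = (∀ v → V v → W v) ⊎ (∀ v → V v → ¬ W v)

-- Two vertices in the same class of the canonical sequence of T are twins: they lie on the
-- same side, and a vertex w of the other side points to either of them exactly when w was
-- removed at an earlier stage. Every part of the M-sequence is closed under twins. For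
-- M±-universality this is the only non-routine point: the transposition (u v) of twins u, v
-- is an automorphism of T, so it carries a topological sort of T[M ∪ {v}] with v first (last)
-- to one of T[M ∪ {u}] with u first (last). This needs u, v ∉ M, which holds because the
-- canonical sequence of T[M] exhausts M (read off the topological sort), so a vertex of M
-- twin to v would make v equivalent to a vertex of some Z_k. Membership in every part is
-- decidable, so a class of the canonical sequence either meets a part, and then lies in it,
-- or is disjoint from it.
module Submission where

open import Defs
open import Data.Bool using (T?)
open import Data.Bool.Properties using () renaming (_≟_ to _≟ᵇ_)
open import Data.Empty using (⊥-elim)
open import Data.Fin using (Fin; toℕ; cast; _≟_) renaming (_<_ to _<ᶠ_)
open import Data.Fin.Induction using (Acc; acc) renaming (<-wellFounded to <ᶠ-wellFounded)
open import Data.Fin.Permutation using (Permutation′; transpose; _⟨$⟩ʳ_; _⟨$⟩ˡ_; inverseˡ; inverseʳ)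
import Data.Fin.Permutation.Components as Transposition
import Data.Fin.Properties as Finₚ
open import Data.Fin.Subset using (Subset; _∈_)
open import Data.Fin.Subset.Properties using (_∈?_)
open import Data.List using (List; []; _∷_; _++_; [_]; length; lookup; map)
open import Data.List.Membership.Propositional using () renaming (_∈_ to _∈ˡ_)
open import Data.List.Membership.Propositional.Properties using (∈-lookup; ∈-map⁺; ∈-map⁻)
open import Data.List.Properties using (length-map; length-++; map-++)
import Data.List.Relation.Unary.All as All
open import Data.List.Relation.Unary.Any using (index)
open import Data.List.Relation.Unary.Any.Properties using (lookup-index)
open import Data.List.Relation.Unary.Unique.Propositional using (Unique; _∷_)
open import Data.List.Relation.Unary.Unique.Propositional.Properties using () renaming (map⁺ to unique-map⁺)
import Data.List.Relation.Unary.Unique.DecPropositional as UniqueDec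
import Data.List.Membership.DecPropositional as MembershipDec
open import Data.Nat using (ℕ; zero; suc; _<_; _≤_; _≤′_; ≤′-refl; ≤′-step; z≤n; s≤s)
import Data.Nat.Properties as ℕₚ
open import Data.Product using (_×_; _,_; proj₁; proj₂; ∃)
open import Data.Sum using (_⊎_; inj₁; inj₂)
open import Data.Unit using (⊤; tt)
open import Function using (_∘_)
open import Function.Bundles using (_⇔_; mk⇔; Equivalence)
import Function.Properties.Equivalence as ⇔
open import Function.Related.TypeIsomorphisms using (¬-cong-⇔)
open import Relation.Nullary using (¬_; Dec; yes; no)
open import Relation.Nullary.Decidable using (_×-dec_; _⊎-dec_; _→-dec_; ¬?; map′)
open import Relation.Binary.PropositionalEquality using (_≡_; _≢_; refl; sym; trans; cong; subst; subst₂)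
import Relation.Binary.Construct.Closure.Transitive as Closure

_⇔?_ : {A B : Set} → Dec A → Dec B → Dec (A ⇔ B)
yes a ⇔? yes b = yes (mk⇔ (λ _ → b) (λ _ → a))
yes a ⇔? no ¬b = no (λ a⇔b → ¬b (Equivalence.to a⇔b a))
no ¬a ⇔? yes b = no (λ a⇔b → ¬a (Equivalence.from a⇔b b))
no ¬a ⇔? no ¬b = yes (mk⇔ (⊥-elim ∘ ¬a) (⊥-elim ∘ ¬b))

∀?-from : {P : ℕ → Set} (l : ℕ) → (∀ j → l ≤ j → P j) → (∀ j → Dec (P j)) → Dec (∀ j → P j)
∀?-from {P} l above P? = map′ extend (λ all {j} _ → all j) (ℕₚ.allUpTo? P? l)
  where
  extend : (∀ {j} → j < l → P j) → ∀ j → P j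
  extend below j with j ℕₚ.<? l
  ... | yes j<l = below j<l
  ... | no j≮l = above j (ℕₚ.≮⇒≥ j≮l)

∃-list≤? : ∀ {n} k (P : List (Fin n) → Set) → (∀ ys → Dec (P ys)) →
           Dec (∃ λ ys → length ys ≤ k × P ys)
∃-list≤? zero P P? with P? []
... | yes p = yes ([] , z≤n , p)
... | no ¬p = no λ { ([] , _ , p) → ¬p p ; (_ ∷ _ , () , _) }
∃-list≤? (suc k) P P? with P? [] | Finₚ.any? (λ x → ∃-list≤? k (P ∘ (x ∷_)) (P? ∘ (x ∷_)))
... | yes p | _ = yes ([] , z≤n , p)
... | no _  | yes (x , ys , ys≤k , p) = yes (x ∷ ys , s≤s ys≤k , p)
... | no ¬p | no ¬q = no λ { ([] , _ , p) → ¬p p ; (x ∷ ys , s≤s ys≤k , p) → ¬q (x , ys , ys≤k , p) }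

∃-list? : ∀ {n} k {P : List (Fin n) → Set} → (∀ ys → P ys → length ys ≤ k) →
          (∀ ys → Dec (P ys)) → Dec (∃ P)
∃-list? k {P} bounded P? =
  map′ (λ (ys , _ , p) → ys , p) (λ (ys , p) → ys , bounded ys p , p) (∃-list≤? k P P?)

lookup-injective : {A : Set} {xs : List A} → Unique xs →
                   ∀ {i j} → lookup xs i ≡ lookup xs j → i ≡ j
lookup-injective {xs = _ ∷ _}  _          {Fin.zero}  {Fin.zero}  _ = refl
lookup-injective {xs = _ ∷ _}  (x∉xs ∷ _) {Fin.zero}  {Fin.suc j} e = ⊥-elim (All.lookup x∉xs (∈-lookup j) e)
lookup-injective {xs = _ ∷ _}  (x∉xs ∷ _) {Fin.suc i} {Fin.zero}  e = ⊥-elim (All.lookup x∉xs (∈-lookup i) (sym e))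
lookup-injective {xs = _ ∷ _}  (_ ∷ u)    {Fin.suc i} {Fin.suc j} e = cong Fin.suc (lookup-injective u e)

unique-length≤ : ∀ {n} {xs : List (Fin n)} → Unique xs → length xs ≤ n
unique-length≤ u = Finₚ.injective⇒≤ (lookup-injective u)

lookup-map : {A B : Set} (f : A → B) (xs : List A) (i : Fin (length (map f xs))) →
             lookup (map f xs) i ≡ f (lookup xs (cast (length-map f xs) i))
lookup-map f (x ∷ xs) Fin.zero    = refl
lookup-map f (x ∷ xs) (Fin.suc i) = lookup-map f xs i

module _ {n : ℕ} (π : Permutation′ n) where

  permutation-injective : ∀ {a b} → π ⟨$⟩ʳ a ≡ π ⟨$⟩ʳ b → a ≡ b
  permutation-injective πa≡πb = trans (sym (inverseˡ π)) (trans (cong (π ⟨$⟩ˡ_) πa≡πb) (inverseˡ π))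

  ∈-map-permutation : ∀ {w xs} → (w ∈ˡ map (π ⟨$⟩ʳ_) xs) ⇔ (π ⟨$⟩ˡ w ∈ˡ xs)
  ∈-map-permutation {w} {xs} = mk⇔ to from
    where
    to : w ∈ˡ map (π ⟨$⟩ʳ_) xs → π ⟨$⟩ˡ w ∈ˡ xs
    to w∈ with ∈-map⁻ (π ⟨$⟩ʳ_) w∈
    ... | x , x∈xs , refl = subst (_∈ˡ xs) (sym (inverseˡ π)) x∈xs
    from : π ⟨$⟩ˡ w ∈ˡ xs → w ∈ˡ map (π ⟨$⟩ʳ_) xs
    from π⁻¹w∈xs = subst (_∈ˡ map (π ⟨$⟩ʳ_) xs) (inverseʳ π) (∈-map⁺ (π ⟨$⟩ʳ_) π⁻¹w∈xs)

transpose-view : ∀ {n} (i j k : Fin n) →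
                 (k ≡ i × Transposition.transpose i j k ≡ j)
                 ⊎ (k ≢ i × k ≡ j × Transposition.transpose i j k ≡ i)
                 ⊎ (k ≢ i × k ≢ j × Transposition.transpose i j k ≡ k)
transpose-view i j k with k ≟ i
... | yes k≡i = inj₁ (k≡i , refl)
... | no k≢i with k ≟ j
...   | yes k≡j = inj₂ (inj₁ (k≢i , k≡j , refl))
...   | no k≢j  = inj₂ (inj₂ (k≢i , k≢j , refl))

transpose-target : ∀ {n} (i j : Fin n) → Transposition.transpose i j j ≡ i
transpose-target i j with transpose-view i j j
... | inj₁ (j≡i , πj≡j) = trans πj≡j j≡i
... | inj₂ (inj₁ (_ , _ , πj≡i)) = πj≡i
... | inj₂ (inj₂ (_ , j≢j , _)) = ⊥-elim (j≢j refl)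

module _ {n : ℕ} (D : BipTournament n) where

  Twin : Fin n → Fin n → Set
  Twin u v = (∀ w → Arc D u w ⇔ Arc D v w) × (∀ w → Arc D w u ⇔ Arc D w v)

  twin-refl : ∀ {u} → Twin u u
  twin-refl = (λ _ → ⇔.refl) , (λ _ → ⇔.refl)

  twin-sym : ∀ {u v} → Twin u v → Twin v u
  twin-sym (out , in′) = (λ w → ⇔.sym (out w)) , (λ w → ⇔.sym (in′ w))

  arc? : ∀ u v → Dec (Arc D u v)
  arc? u v = T? (arc D u v)

  arc⇔¬reverse : ∀ {u w} → side D u ≢ side D w → Arc D u w ⇔ (¬ Arc D w u)
  arc⇔¬reverse {u} {w} u≁w with exactlyOne D u w u≁w
  ... | inj₁ (uw , ¬wu) = mk⇔ (λ _ → ¬wu) (λ _ → uw)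
  ... | inj₂ (wu , ¬uw) = mk⇔ (λ uw → ⊥-elim (¬uw uw)) (λ ¬wu → ⊥-elim (¬wu wu))

  acyclic⇒acyclicOn : Acyclic D → ∀ S → AcyclicOn D S
  acyclic⇒acyclicOn acyclic S (v , cycle) = acyclic (v , weaken cycle)
    where
    weaken : ∀ {x y} → Closure.TransClosure (ArcIn D S) x y → Closure.TransClosure (ArcIn D (λ _ → ⊤)) x y
    weaken Closure.[ (_ , _ , a) ] = Closure.[ (tt , tt , a) ]
    weaken ((_ , _ , a) Closure.∷ rest) = (tt , tt , a) Closure.∷ weaken rest

  module _ {S : VSet n} (S? : ∀ v → Dec (S v)) where

    mutual
      removedIn? : ∀ i v → Dec (RemovedIn D S i v)
      removedIn? zero v = no λ ()
      removedIn? (suc i) v = removedIn? i v ⊎-dec canonIn? i v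

      canonIn? : ∀ i v → Dec (CanonIn D S i v)
      canonIn? i v = S? v ×-dec (¬? (removedIn? i v) ×-dec
        Finₚ.all? (λ u → S? u →-dec (¬? (removedIn? i u) →-dec ¬? (arc? u v))))

  removedIn-mono′ : ∀ {S i j v} → i ≤′ j → RemovedIn D S i v → RemovedIn D S j v
  removedIn-mono′ ≤′-refl r = r
  removedIn-mono′ (≤′-step i≤j) r = inj₁ (removedIn-mono′ i≤j r)

  removedIn-mono : ∀ {S i j v} → i ≤ j → RemovedIn D S i v → RemovedIn D S j v
  removedIn-mono = removedIn-mono′ ∘ ℕₚ.≤⇒≤′

  removedIn⇒canonIn : ∀ {S i v} → RemovedIn D S i v → ∃ λ k → CanonIn D S k v
  removedIn⇒canonIn {i = suc i} (inj₁ r) = removedIn⇒canonIn r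
  removedIn⇒canonIn {i = suc i} (inj₂ c) = i , c

  ¬arc-into-removedIn : ∀ {S i u w} → S u → ¬ RemovedIn D S i u → RemovedIn D S i w → ¬ Arc D u w
  ¬arc-into-removedIn {i = suc i} su nru (inj₁ rw) = ¬arc-into-removedIn su (nru ∘ inj₁) rw
  ¬arc-into-removedIn {i = suc i} su nru (inj₂ (_ , _ , noIn)) = noIn _ su (nru ∘ inj₁)

  canonIn-suc⊆ : ∀ {S i z} → (∀ v → ¬ CanonIn D S i v) → CanonIn D S (suc i) z → CanonIn D S i z
  canonIn-suc⊆ empty (sz , nrz , noIn) =
    sz , nrz ∘ inj₁ , λ u su nru → noIn u su λ { (inj₁ r) → nru r ; (inj₂ c) → empty u c }

  canonIn-empty-from′ : ∀ {S l j} → (∀ v → ¬ CanonIn D S l v) → l ≤′ j → ∀ v → ¬ CanonIn D S j v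
  canonIn-empty-from′ empty ≤′-refl = empty
  canonIn-empty-from′ empty (≤′-step l≤j) v =
    canonIn-empty-from′ empty l≤j v ∘ canonIn-suc⊆ (canonIn-empty-from′ empty l≤j)

  canonIn-empty-from : ∀ {S l j} → (∀ v → ¬ CanonIn D S l v) → l ≤ j → ∀ v → ¬ CanonIn D S j v
  canonIn-empty-from empty = canonIn-empty-from′ empty ∘ ℕₚ.≤⇒≤′

  Removed : ℕ → VSet n
  Removed = RemovedIn D (λ _ → ⊤)

  canon-sameSide : ∀ {i u v} → Canon D i u → Canon D i v → side D u ≡ side D v
  canon-sameSide {u = u} {v} (_ , nru , noIntoU) (_ , nrv , noIntoV) with side D u ≟ᵇ side D v
  ... | yes u~v = u~v
  ... | no u≁v with exactlyOne D u v u≁v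
  ...   | inj₁ (uv , _) = ⊥-elim (noIntoV u tt nru uv)
  ...   | inj₂ (vu , _) = ⊥-elim (noIntoU v tt nrv vu)

  arc-into-canon⇔removed : ∀ {i c w} → Canon D i c → side D w ≢ side D c → Arc D w c ⇔ Removed i w
  arc-into-canon⇔removed {i} {c} {w} (_ , nrc , noIntoC) w≁c = mk⇔ into-removed from-removed
    where
    into-removed : Arc D w c → Removed i w
    into-removed wc with removedIn? (λ _ → yes tt) i w
    ... | yes rw = rw
    ... | no nrw = ⊥-elim (noIntoC w tt nrw wc)
    from-removed : Removed i w → Arc D w c
    from-removed rw = Equivalence.from (arc⇔¬reverse w≁c) (¬arc-into-removedIn tt nrc rw)

  canon-twins : ∀ {i u v} → Canon D i u → Canon D i v → Twin u v
  canon-twins {i} {u} {v} cu cv = out , in′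
    where
    u~v : side D u ≡ side D v
    u~v = canon-sameSide cu cv
    absent : ∀ {A B : Set} → ¬ A → ¬ B → A ⇔ B
    absent ¬a ¬b = mk⇔ (⊥-elim ∘ ¬a) (⊥-elim ∘ ¬b)
    in′ : ∀ w → Arc D w u ⇔ Arc D w v
    in′ w with side D w ≟ᵇ side D u
    ... | yes w~u = absent (noArcInside D w u w~u) (noArcInside D w v (trans w~u u~v))
    ... | no w≁u = ⇔.trans (arc-into-canon⇔removed cu w≁u)
                           (⇔.sym (arc-into-canon⇔removed cv (λ w~v → w≁u (trans w~v (sym u~v)))))
    out : ∀ w → Arc D u w ⇔ Arc D v w
    out w with side D w ≟ᵇ side D u
    ... | yes w~u = absent (noArcInside D u w (sym w~u)) (noArcInside D v w (sym (trans w~u u~v)))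
    ... | no w≁u = ⇔.trans (arc⇔¬reverse (w≁u ∘ sym))
                   (⇔.trans (¬-cong-⇔ (in′ w))
                            (⇔.sym (arc⇔¬reverse (λ v~w → w≁u (sym (trans u~v v~w))))))

  canon-subsetOrDisjoint : ∀ i {W : VSet n} → (∀ v → Dec (W v)) → (∀ {u v} → Twin u v → W v → W u) →
                           SubsetOrDisjoint (Canon D i) W
  canon-subsetOrDisjoint i W? twin-closed
    with Finₚ.any? (λ v → canonIn? (λ _ → yes tt) i v ×-dec W? v)
  ... | yes (v , cv , wv) = inj₁ (λ u cu → twin-closed (canon-twins cu cv) wv)
  ... | no ¬meets = inj₂ (λ u cu wu → ¬meets (u , cu , wu))

  ForwardArcs : List (Fin n) → Set
  ForwardArcs xs = ∀ i j → Arc D (lookup xs i) (lookup xs j) → i <ᶠ j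

  module _ {S : VSet n} (S? : ∀ v → Dec (S v)) {xs : List (Fin n)}
           (forward : ForwardArcs xs) (listed : ∀ {u} → S u → u ∈ˡ xs) where

    removedIn-by-position : ∀ {u} (u∈xs : u ∈ˡ xs) → Acc _<ᶠ_ (index u∈xs) → S u →
                            RemovedIn D S (suc (toℕ (index u∈xs))) u
    removedIn-by-position {u} u∈xs (acc earlier) su with removedIn? S? (toℕ (index u∈xs)) u
    ... | yes ru = inj₁ ru
    ... | no nru = inj₂ (su , nru , noArcFromLater)
      where
      noArcFromLater : ∀ w → S w → ¬ RemovedIn D S (toℕ (index u∈xs)) w → ¬ Arc D w u
      noArcFromLater w sw nrw wu = nrw (removedIn-mono w<u (removedIn-by-position (listed sw) (earlier w<u) sw))
        where
        w<u : index (listed sw) <ᶠ index u∈xs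
        w<u = forward _ _ (subst₂ (Arc D) (lookup-index (listed sw)) (lookup-index u∈xs) wu)

    canonIn-covers : ∀ {u} → S u → ∃ λ k → CanonIn D S k u
    canonIn-covers su = removedIn⇒canonIn (removedIn-by-position (listed su) (<ᶠ-wellFounded _) su)

  module _ (π : Permutation′ n) (π-twin : ∀ k → Twin (π ⟨$⟩ʳ k) k) where

    forwardArcs-map : ∀ {xs} → ForwardArcs xs → ForwardArcs (map (π ⟨$⟩ʳ_) xs)
    forwardArcs-map {xs} forward i j πij =
      subst₂ _<_ (Finₚ.toℕ-cast _ i) (Finₚ.toℕ-cast _ j)
        (forward _ _ (reflect (subst₂ (Arc D) (lookup-map _ xs i) (lookup-map _ xs j) πij)))
      where
      reflect : ∀ {a b} → Arc D (π ⟨$⟩ʳ a) (π ⟨$⟩ʳ b) → Arc D a b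
      reflect {a} {b} = Equivalence.to (proj₂ (π-twin b) a) ∘ Equivalence.to (proj₁ (π-twin a) _)

    topSort-map : ∀ {S S′ xs} → (∀ w → S′ w ⇔ S (π ⟨$⟩ˡ w)) →
                  TopSort D S xs → TopSort D S′ (map (π ⟨$⟩ʳ_) xs)
    topSort-map {xs = xs} S′⇔S∘π⁻¹ (unique , members , forward) =
      unique-map⁺ (permutation-injective π) unique ,
      (λ w → ⇔.trans (∈-map-permutation π) (⇔.trans (members _) (⇔.sym (S′⇔S∘π⁻¹ w)))) ,
      forwardArcs-map {xs} forward

  twin-transpose : ∀ {u v} → Twin u v → ∀ k → Twin (transpose u v ⟨$⟩ʳ k) k
  twin-transpose {u} {v} u≈v k with transpose-view u v k
  ... | inj₁ (refl , πk≡v) rewrite πk≡v = twin-sym u≈v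
  ... | inj₂ (inj₁ (_ , refl , πk≡u)) rewrite πk≡u = u≈v
  ... | inj₂ (inj₂ (_ , _ , πk≡k)) rewrite πk≡k = twin-refl

  topSort? : ∀ {S} → (∀ v → Dec (S v)) → ∀ xs → Dec (TopSort D S xs)
  topSort? S? xs = UniqueDec.unique? _≟_ xs ×-dec
    (Finₚ.all? (λ u → MembershipDec._∈?_ _≟_ u xs ⇔? S? u) ×-dec
     Finₚ.all? (λ i → Finₚ.all? (λ j → arc? (lookup xs i) (lookup xs j) →-dec (i Finₚ.<? j))))

  -- A topological sort is a duplicate-free list over Fin n, so it has length at most n
  -- and its existence can be decided by exhaustive search.
  ∃-topSort? : ∀ {S} → (∀ v → Dec (S v)) → (f : List (Fin n) → List (Fin n)) →
               (∀ ys → length ys ≤ length (f ys)) → Dec (∃ λ ys → TopSort D S (f ys))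
  ∃-topSort? S? f grows =
    ∃-list? n (λ ys sort → ℕₚ.≤-trans (grows ys) (unique-length≤ (proj₁ sort))) (topSort? S? ∘ f)

module _ {n : ℕ} (D : BipTournament n) (M : Subset n) where

  inM? : ∀ v → Dec (InM D M v)
  inM? v = v ∈? M

  inMv? : ∀ v u → Dec (InMv D M v u)
  inMv? v u = (u ∈? M) ⊎-dec (u ≟ v)

  Z? : ∀ i v → Dec (Z D M i v)
  Z? = canonIn? D inM?

  twin⇒MEquivalent : ∀ {u v} → Twin D u v → MEquivalent D M u v
  twin⇒MEquivalent (out , in′) = (λ w _ → out w) , (λ w _ → in′ w)

  MEquivalent-trans : ∀ {u v w} → MEquivalent D M u v → MEquivalent D M v w → MEquivalent D M u w
  MEquivalent-trans (out , in′) (out′ , in″) =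
    (λ x x∈M → ⇔.trans (out x x∈M) (out′ x x∈M)) , (λ x x∈M → ⇔.trans (in′ x x∈M) (in″ x x∈M))

  MEquivalent? : ∀ u v → Dec (MEquivalent D M u v)
  MEquivalent? u v =
    Finₚ.all? (λ w → (w ∈? M) →-dec (arc? D u w ⇔? arc? D v w)) ×-dec
    Finₚ.all? (λ w → (w ∈? M) →-dec (arc? D w u ⇔? arc? D w v))

  ZEquivalent? : ∀ i v → Dec (ZEquivalent D M i v)
  ZEquivalent? i v = Finₚ.any? (λ z → Z? i z ×-dec MEquivalent? v z)

  ZEquivalent-twin : ∀ {i u v} → Twin D u v → ZEquivalent D M i v → ZEquivalent D M i u
  ZEquivalent-twin u≈v (z , zz , v≈z) = z , zz , MEquivalent-trans (twin⇒MEquivalent u≈v) v≈z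

  ZConflicting-twin : ∀ {i u v} → Twin D u v → ZConflicting D M i v → ZConflicting D M i u
  ZConflicting-twin (out , in′) ((z , zz , vz) , (z′ , zz′ , z′v) , noOutBefore , noInAfter) =
    (z , zz , Equivalence.from (out z) vz) ,
    (z′ , zz′ , Equivalence.from (in′ z′) z′v) ,
    (λ k k<i y yy uy → noOutBefore k k<i y yy (Equivalence.to (out y) uy)) ,
    (λ k i<k y yy yu → noInAfter k i<k y yy (Equivalence.to (in′ y) yu))

  inMv-transpose : ∀ {u v} → ¬ u ∈ M → ¬ v ∈ M →
                   ∀ w → InMv D M u w ⇔ InMv D M v (transpose u v ⟨$⟩ˡ w)
  inMv-transpose {u} {v} u∉M v∉M w with transpose-view v u w
  ... | inj₁ (refl , πw≡u) rewrite πw≡u =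
    mk⇔ (λ { (inj₁ v∈M) → ⊥-elim (v∉M v∈M) ; (inj₂ refl) → inj₂ refl })
        (λ { (inj₁ u∈M) → ⊥-elim (u∉M u∈M) ; (inj₂ refl) → inj₂ refl })
  ... | inj₂ (inj₁ (_ , refl , πw≡v)) rewrite πw≡v = mk⇔ (λ _ → inj₂ refl) (λ _ → inj₂ refl)
  ... | inj₂ (inj₂ (w≢v , w≢u , πw≡w)) rewrite πw≡w =
    mk⇔ (λ { (inj₁ w∈M) → inj₁ w∈M ; (inj₂ w≡u) → ⊥-elim (w≢u w≡u) })
        (λ { (inj₁ w∈M) → inj₁ w∈M ; (inj₂ w≡v) → ⊥-elim (w≢v w≡v) })

  universal-twin∉M : ∀ {u v xs} → UniversalBase D M v → TopSort D (InMv D M v) xs → Twin D u v → ¬ u ∈ M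
  universal-twin∉M (notEquivalent , _) (_ , members , forward) u≈v u∈M
    with canonIn-covers D inM? forward (λ w∈M → Equivalence.from (members _) (inj₁ w∈M)) u∈M
  ... | k , zku = notEquivalent k (_ , zku , twin⇒MEquivalent (twin-sym D u≈v))

  universal-topSort-twin : ∀ {u v xs} → UniversalBase D M v → Twin D u v →
                           TopSort D (InMv D M v) xs → TopSort D (InMv D M u) (map (transpose u v ⟨$⟩ʳ_) xs)
  universal-topSort-twin universal u≈v sort =
    topSort-map D (transpose _ _) (twin-transpose D u≈v)
      (inMv-transpose (universal-twin∉M universal sort u≈v) (universal-twin∉M universal sort (twin-refl D)))
      sort

  module _ (acyclic : Acyclic D) where

    UniversalBase-twin : ∀ {u v} → Twin D u v → UniversalBase D M v → UniversalBase D M u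
    UniversalBase-twin u≈v (notEquivalent , _) =
      (λ i → notEquivalent i ∘ ZEquivalent-twin (twin-sym D u≈v)) , acyclic⇒acyclicOn D acyclic _

    MinusUniversal-twin : ∀ {u v} → Twin D u v → MinusUniversal D M v → MinusUniversal D M u
    MinusUniversal-twin {u} {v} u≈v (universal , ys , sort) =
      UniversalBase-twin u≈v universal , map (π ⟨$⟩ʳ_) ys ,
      subst (λ x → TopSort D (InMv D M u) (x ∷ map (π ⟨$⟩ʳ_) ys)) (transpose-target u v)
        (universal-topSort-twin universal u≈v sort)
      where
      π = transpose u v

    PlusUniversal-twin : ∀ {u v} → Twin D u v → PlusUniversal D M v → PlusUniversal D M u
    PlusUniversal-twin {u} {v} u≈v (universal , ys , sort) =
      UniversalBase-twin u≈v universal , map (π ⟨$⟩ʳ_) ys ,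
      subst (λ x → TopSort D (InMv D M u) (map (π ⟨$⟩ʳ_) ys ++ [ x ])) (transpose-target u v)
        (subst (TopSort D (InMv D M u)) (map-++ (π ⟨$⟩ʳ_) ys [ v ])
          (universal-topSort-twin universal u≈v sort))
      where
      π = transpose u v

    Y-twin : ∀ {l j u v} → Twin D u v → Y D M l j v → Y D M l j u
    Y-twin u≈v (inj₁ conflicting)            = inj₁ (ZConflicting-twin u≈v conflicting)
    Y-twin u≈v (inj₂ (inj₁ (j≡0 , minus)))   = inj₂ (inj₁ (j≡0 , MinusUniversal-twin u≈v minus))
    Y-twin u≈v (inj₂ (inj₂ (j+1≡l , plus)))  = inj₂ (inj₂ (j+1≡l , PlusUniversal-twin u≈v plus))

    module _ {l : ℕ} (Zₗ-empty : ∀ z → ¬ Z D M l z) where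

      Z-empty-from : ∀ {j} → l ≤ j → ∀ z → ¬ Z D M j z
      Z-empty-from = canonIn-empty-from D Zₗ-empty

      UniversalBase? : ∀ v → Dec (UniversalBase D M v)
      UniversalBase? v =
        ∀?-from l (λ j l≤j (z , zz , _) → Z-empty-from l≤j z zz) (λ i → ¬? (ZEquivalent? i v))
        ×-dec yes (acyclic⇒acyclicOn D acyclic _)

      MinusUniversal? : ∀ v → Dec (MinusUniversal D M v)
      MinusUniversal? v = UniversalBase? v ×-dec ∃-topSort? D (inMv? v) (v ∷_) (ℕₚ.n≤1+n ∘ length)

      PlusUniversal? : ∀ v → Dec (PlusUniversal D M v)
      PlusUniversal? v = UniversalBase? v ×-dec ∃-topSort? D (inMv? v) (_++ [ v ]) grows
        where
        grows : ∀ ys → length ys ≤ length (ys ++ [ v ])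
        grows ys = subst (length ys ≤_) (sym (length-++ ys)) (ℕₚ.m≤m+n (length ys) 1)

      ZConflicting? : ∀ i v → Dec (ZConflicting D M i v)
      ZConflicting? i v =
        Finₚ.any? (λ z → Z? i z ×-dec arc? D v z) ×-dec
        (Finₚ.any? (λ z → Z? i z ×-dec arc? D z v) ×-dec
        (∀?-from i (λ j i≤j j<i → ⊥-elim (ℕₚ.≤⇒≯ i≤j j<i))
           (λ j → (j ℕₚ.<? i) →-dec Finₚ.all? (λ z → Z? j z →-dec ¬? (arc? D v z))) ×-dec
         ∀?-from l (λ j l≤j _ z zz _ → Z-empty-from l≤j z zz)
           (λ j → (i ℕₚ.<? j) →-dec Finₚ.all? (λ z → Z? j z →-dec ¬? (arc? D z v)))))

      Y? : ∀ j v → Dec (Y D M l j v)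
      Y? j v = ZConflicting? j v
               ⊎-dec ((j ℕₚ.≟ zero ×-dec MinusUniversal? v) ⊎-dec (suc j ℕₚ.≟ l ×-dec PlusUniversal? v))

lemma18 : ∀ {n} (D : BipTournament n) → Acyclic D → (M : Subset n) →
    ∀ l → IsSeqLength D M l → ∀ i j → j < l →
    SubsetOrDisjoint (Canon D i) (X D M j) × SubsetOrDisjoint (Canon D i) (Y D M l j)
lemma18 D acyclic M l (_ , Zₗ-empty) i j _ =
  canon-subsetOrDisjoint D i (ZEquivalent? D M j) (ZEquivalent-twin D M) ,
  canon-subsetOrDisjoint D i (Y? D M acyclic Zₗ-empty j) (Y-twin D M acyclic)
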